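{- Let $$F(t;x,q,w,u,z)=\sum_{s\in\mathcal{A},\ |s|>\mathsf{max}(s)}t^{|s|}x^{\mathsf{rep}(s)}q^{\mathsf{max}(s)}w^{\mathsf{ealm}(s)}u^{\mathsf{asc}(s)}z^{\mathsf{zero}(s)}.$$ Then $$\sum_{s\in\mathcal{S}_2}t^{|s|}x^{\mathsf{rep}(s)}q^{\mathsf{max}(s)}w^{\mathsf{ealm}(s)}u^{\mathsf{asc}(s)}z^{\mathsf{zero}(s)}=\frac{tx}{1-w}\big(F(t;x,q,w,u,z)-F(t;x,qw,1,u,z)\big)+tx(z-1)F(t;x,q,0,u,z).$$
   Context: An inversion sequence of length $n$ is $s=(s_1,\dots,s_n)$ with $0\le s_i<i$; $|s|$ is its length. $\mathsf{asc}(s)=|\{i\in[n-1]:s_i<s_{i+1}\}|$; $\mathsf{rep}(s)=n-|\{s_1,\dots,s_n\}|$; $\mathsf{zero}(s)=|\{i:s_i=0\}|$; $\mathsf{max}(s)=|\{i:s_i=i-1\}|$. An ascent sequence is an inversion sequence with $s_i\le\mathsf{asc}(s_1,\dots,s_{i-1})+1$ for $2\le i\le n$; $\mathcal{A}$ is the set of all ascent sequences (of all lengths $\ge1$). For an ascent sequence with $p=\mathsf{max}(s)<|s|$, $\mathsf{ealm}(s)=s_{p+1}$. $\mathcal{S}_2$ is the set of ascent sequences $s$ with $p=\mathsf{max}(s)$, $|s|\ge p+2$ and $s_{p+1}\ge s_{p+2}$. Power series are formal in $t$, with the convention $0^0=1$ when substituting $w=0$. -}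

module Defs where

open import Data.Bool using (Bool; true; false; _∧_; if_then_else_)
open import Data.Nat using (ℕ; zero; suc; _∸_; _<ᵇ_; _≤ᵇ_; _≡ᵇ_) renaming (_+_ to _+ℕ_)
import Data.Nat as ℕ
open import Data.List using (List; []; _∷_; _++_; length; map; concatMap; upTo; take; deduplicate)
open import Data.Integer using (ℤ; +_; _+_; _*_; _-_; _^_)

-- Sequences s = (s_1, ..., s_n) are lists; positions are 1-based in the paper,
-- 0-based in 'at'.  'at s k' = s_{k+1} (default 0 outside the range, never used there).
at : List ℕ → ℕ → ℕ
at []       _       = 0
at (a ∷ _)  zero    = a
at (_ ∷ s)  (suc k) = at s k

invSeqs : ℕ → List (List ℕ)
invSeqs zero    = [] ∷ []
invSeqs (suc n) = concatMap (λ s → map (λ v → s ++ (v ∷ [])) (upTo (suc n))) (invSeqs n)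

count : (ℕ → ℕ → Bool) → List ℕ → ℕ
count p s = go 0 s
  where
  go : ℕ → List ℕ → ℕ
  go _ []      = 0
  go i (a ∷ r) = (if p i a then 1 else 0) +ℕ go (suc i) r

asc : List ℕ → ℕ
asc []            = 0
asc (a ∷ [])      = 0
asc (a ∷ b ∷ r)   = (if a <ᵇ b then 1 else 0) +ℕ asc (b ∷ r)

rep : List ℕ → ℕ
rep s = length s ∸ length (deduplicate ℕ._≟_ s)

zeros : List ℕ → ℕ
zeros = count (λ _ a → a ≡ᵇ 0)

-- max(s) = #{ i : s_i = i - 1 }   (with 0-based index j = i-1: s_i = j)
maxs : List ℕ → ℕ
maxs = count (λ j a → a ≡ᵇ j)

-- ascent condition: for 2 ≤ i ≤ n, s_i ≤ asc(s_1,…,s_{i-1}) + 1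
-- (0-based index k = i - 1 ranges over 1 … n-1, prefix s_1..s_{i-1} = take k s)
isAscent : List ℕ → Bool
isAscent s = go 1 (length s)
  where
  go : ℕ → ℕ → Bool
  go k zero    = true
  go k (suc m) = (if k <ᵇ length s then at s k ≤ᵇ suc (asc (take k s)) else true) ∧ go (suc k) m

ealm : List ℕ → ℕ
ealm s = at s (maxs s)

inF : List ℕ → Bool
inF s = isAscent s ∧ (1 ≤ᵇ length s) ∧ (maxs s <ᵇ length s)

inS2 : List ℕ → Bool
inS2 s = isAscent s ∧ (suc (suc (maxs s)) ≤ᵇ length s)
                    ∧ (at s (suc (maxs s)) ≤ᵇ at s (maxs s))

sumWhere : (List ℕ → Bool) → (List ℕ → ℤ) → List (List ℕ) → ℤ
sumWhere p f []       = + 0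
sumWhere p f (s ∷ ss) = (if p s then f s else + 0) + sumWhere p f ss

-- weight x^rep q^max w^ealm u^asc z^zero  (ℤ's _^_ gives 0^0 = 1)
wt : ℤ → ℤ → ℤ → ℤ → ℤ → List ℕ → ℤ
wt x q w u z s = x ^ rep s * q ^ maxs s * w ^ ealm s * u ^ asc s * z ^ zeros s

-- coefficient of t^n in F(t;x,q,w,u,z)
Fc : ℕ → ℤ → ℤ → ℤ → ℤ → ℤ → ℤ
Fc n x q w u z = sumWhere inF (wt x q w u z) (invSeqs n)

-- coefficient of t^n in the left-hand side (sum over 𝒮₂)
S2c : ℕ → ℤ → ℤ → ℤ → ℤ → ℤ → ℤ
S2c n x q w u z = sumWhere inS2 (wt x q w u z) (invSeqs n)

-- An element s of F has the form 0 1 ⋯ m b r with b ≤ m: once an ascent sequence has left its initial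
-- run it can never again satisfy s_i = i - 1, so max s = m + 1 and ealm s = b.  Inserting a value a with
-- b ≤ a ≤ m right after the run gives a sequence of 𝒮₂ with one more repeated value, the same max and
-- ascents, ealm a, and one more zero iff a = 0; conversely every sequence of 𝒮₂ of length n + 1 arises in
-- exactly one way from an s ∈ F of length n (delete the entry after the run).  So, up to the factor x,
-- the weight w^b of s is replaced by the sum of w^a over b ≤ a ≤ m, with an extra factor z at a = 0.  Multiplied
-- by 1 - w the sum telescopes to w^b - w^(m+1), which accounts for F(q, w) - F(qw, 1); the correction at
-- a = 0 occurs only when b = 0, that is with weight 0^b, and accounts for (z - 1) F(q, 0).

module Submission where

open import Defs
open import Data.Nat using (ℕ; suc)
open import Data.Integer using (ℤ; +_; _+_; _*_; _-_)
open import Data.Product using (_×_)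
open import Relation.Binary.PropositionalEquality using (_≡_)

open import Data.Bool using (Bool; true; false; T; if_then_else_; _∧_)
open import Data.Bool.Properties using (T-∧)
open import Data.Empty using (⊥-elim)
open import Data.Integer using (0ℤ; 1ℤ; _^_)
open import Data.Integer.Properties
  using (+-0-isCommutativeMonoid; +-identityˡ; +-assoc; +-inverseʳ; *-identityʳ; *-zeroʳ; *-distribˡ-+;
         *-commutativeSemigroup; ^-zeroˡ; ^-distribˡ-+-*)
open import Data.Integer.Tactic.RingSolver using (solve-∀)
open import Data.List
  using (List; []; _∷_; _++_; _∷ʳ_; length; map; foldr; concatMap; filterᵇ; take; drop; upTo; deduplicate; initLast; _∷ʳ′_)
open import Data.List.Properties
  using (∷-injectiveˡ; ++-cancelˡ; map-cong; ∷ʳ-injectiveˡ; ∷ʳ-injectiveʳ; ∷ʳ-++; length-++; length-++-sucʳ; length-deduplicate)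
open import Data.List.Membership.Propositional using (_∈_; find; lose)
open import Data.List.Membership.Propositional.Properties
  using (∈-filter⁺; ∈-filter⁻; ∈-++⁺ˡ; ∈-++⁺ʳ; ∈-++⁻; ∈-deduplicate⁺; ∈-deduplicate⁻; ∈-concatMap⁺; ∈-concatMap⁻;
         ∈-map⁺; ∈-map⁻; ∈-upTo⁺; ∈-upTo⁻)
open import Data.List.Membership.Propositional.Properties.WithK using (unique∧set⇒bag)
open import Data.List.Relation.Binary.BagAndSetEquality using (_∼[_]_; set; ∼bag⇒↭)
open import Data.List.Relation.Binary.Disjoint.Propositional using (Disjoint)
open import Data.List.Relation.Binary.Permutation.Propositional using (_↭_; ↭⇒↭ₛ)
open import Data.List.Relation.Binary.Permutation.Propositional.Properties using (↭-length) renaming (map⁺ to ↭-map⁺)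
import Data.List.Relation.Binary.Permutation.Setoid.Properties as ↭ₛ
import Data.List.Relation.Unary.All as All
open import Data.List.Relation.Unary.All using ([])
open import Data.List.Relation.Unary.AllPairs using ([]; _∷_)
open import Data.List.Relation.Unary.Any using (here; there)
open import Data.List.Relation.Unary.Unique.Propositional using (Unique)
import Data.List.Relation.Unary.Unique.Propositional.Properties as Unique
open import Data.Nat using (zero; _∸_; _≤_; _<_; z≤n; s≤s; s≤s⁻¹; z<s; _<ᵇ_; _≤ᵇ_; _≡ᵇ_) renaming (_+_ to _+ℕ_)
open import Data.Nat.Properties
  using (_≟_; ≤-refl; ≤-reflexive; ≤-trans; <-irrefl; <⇒≤; <⇒≱; <⇒≢; <-≤-trans; ≤∧≢⇒<; n≤1+n; n<1+n; m≤n⇒m≤1+n;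
         m<m+n; <ᵇ⇒<; <⇒<ᵇ; ≤ᵇ⇒≤; ≤⇒≤ᵇ; ≡ᵇ⇒≡; ≡⇒≡ᵇ; +-monoʳ-≤; +-suc; +-∸-assoc; m+[n∸m]≡n; suc-injective;
         +-commutativeSemigroup)
  renaming (+-comm to +ℕ-comm; +-assoc to +ℕ-assoc; +-identityʳ to +ℕ-identityʳ)
open import Data.Product using (_,_; proj₁; proj₂; ∃)
open import Data.Sum using (inj₁; inj₂)
open import Data.Unit using (⊤; tt)
open import Function using (_∘_; Equivalence; mk⇔)
open import Relation.Binary.PropositionalEquality
  using (_≢_; refl; sym; trans; cong; cong₂; subst; subst₂; setoid; module ≡-Reasoning)
open import Relation.Nullary using (¬_; yes; no)
open import Relation.Nullary.Decidable using (T?)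

open import Algebra.Properties.CommutativeSemigroup +-commutativeSemigroup using () renaming (x∙yz≈y∙xz to +ℕ-left-comm)
open import Algebra.Properties.CommutativeSemigroup *-commutativeSemigroup using () renaming (x∙yz≈y∙xz to *-left-comm)
open import Data.List.Relation.Unary.Unique.DecPropositional.Properties _≟_ using (deduplicate-!)

if-T : ∀ {A : Set} {b} {x y : A} → T b → (if b then x else y) ≡ x
if-T {b = true} _ = refl

if-¬T : ∀ {A : Set} {b} {x y : A} → ¬ T b → (if b then x else y) ≡ y
if-¬T {b = false} _  = refl
if-¬T {b = true}  ¬t = ⊥-elim (¬t tt)

∧-T : ∀ {b c} → T b → b ∧ c ≡ c
∧-T {true} _ = refl

length-∷ʳ : {A : Set} (xs : List A) {x : A} → length (xs ∷ʳ x) ≡ suc (length xs)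
length-∷ʳ []       = refl
length-∷ʳ (_ ∷ xs) = cong suc (length-∷ʳ xs)

∈-filterᵇ⁻ : ∀ {A : Set} (p : A → Bool) {s} xs → s ∈ filterᵇ p xs → s ∈ xs × T (p s)
∈-filterᵇ⁻ p xs = ∈-filter⁻ (T? ∘ p) {xs = xs}

∈-filterᵇ⁺ : ∀ {A : Set} (p : A → Bool) {s} xs → s ∈ xs → T (p s) → s ∈ filterᵇ p xs
∈-filterᵇ⁺ p xs = ∈-filter⁺ (T? ∘ p) {xs = xs}

-- Finite sums

∑ : {A : Set} → List A → (A → ℤ) → ℤ
∑ xs f = foldr _+_ 0ℤ (map f xs)

infix 5 ∑
syntax ∑ xs (λ x → e) = ∑[ x ∈ xs ] e

module _ {A : Set} where

  ∑-cong : ∀ {xs : List A} {f g : A → ℤ} → (∀ {x} → x ∈ xs → f x ≡ g x) → ∑ xs f ≡ ∑ xs g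
  ∑-cong {[]}     eq = refl
  ∑-cong {x ∷ xs} eq = cong₂ _+_ (eq (here refl)) (∑-cong (eq ∘ there))

  ∑-++ : ∀ (xs ys : List A) f → ∑ (xs ++ ys) f ≡ ∑ xs f + ∑ ys f
  ∑-++ []       ys f = sym (+-identityˡ _)
  ∑-++ (x ∷ xs) ys f = trans (cong (_+_ (f x)) (∑-++ xs ys f)) (sym (+-assoc (f x) _ _))

  ∑-+ : ∀ (xs : List A) f g → ∑[ x ∈ xs ] (f x + g x) ≡ ∑ xs f + ∑ xs g
  ∑-+ []       f g = refl
  ∑-+ (x ∷ xs) f g = trans (cong (_+_ (f x + g x)) (∑-+ xs f g)) (interchange (f x) (g x) _ _)
    where
    interchange : ∀ a b c d → a + b + (c + d) ≡ a + c + (b + d)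
    interchange = solve-∀

  ∑-- : ∀ (xs : List A) f g → ∑[ x ∈ xs ] (f x - g x) ≡ ∑ xs f - ∑ xs g
  ∑-- []       f g = refl
  ∑-- (x ∷ xs) f g = trans (cong (_+_ (f x - g x)) (∑-- xs f g)) (interchange (f x) (g x) _ _)
    where
    interchange : ∀ a b c d → a - b + (c - d) ≡ a + c - (b + d)
    interchange = solve-∀

  ∑-*ˡ : ∀ (xs : List A) c f → ∑[ x ∈ xs ] (c * f x) ≡ c * ∑ xs f
  ∑-*ˡ []       c f = sym (*-zeroʳ c)
  ∑-*ˡ (x ∷ xs) c f = trans (cong (_+_ (c * f x)) (∑-*ˡ xs c f)) (sym (*-distribˡ-+ c (f x) _))

  ∑-↭ : ∀ {xs ys : List A} f → xs ↭ ys → ∑ xs f ≡ ∑ ys f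
  ∑-↭ f p = ↭ₛ.foldr-commMonoid (setoid ℤ) +-0-isCommutativeMonoid (↭⇒↭ₛ (↭-map⁺ f p))

  ∑-combination : ∀ (xs : List A) a c d f g h →
                  ∑[ x ∈ xs ] (a * (f x - g x) + c * (a * (d * h x))) ≡ a * (∑ xs f - ∑ xs g) + c * (a * (d * ∑ xs h))
  ∑-combination xs a c d f g h = trans (∑-+ xs _ _) (cong₂ _+_
    (trans (∑-*ˡ xs a _) (cong (a *_) (∑-- xs f g)))
    (trans (∑-*ˡ xs c _) (cong (c *_) (trans (∑-*ˡ xs a _) (cong (a *_) (∑-*ˡ xs d h))))))

module _ {A B : Set} where

  ∑-map : ∀ (g : A → B) xs f → ∑ (map g xs) f ≡ ∑ xs (f ∘ g)
  ∑-map g []       f = refl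
  ∑-map g (x ∷ xs) f = cong (_+_ (f (g x))) (∑-map g xs f)

  ∑-concatMap : ∀ (g : A → List B) xs f → ∑ (concatMap g xs) f ≡ ∑[ x ∈ xs ] ∑ (g x) f
  ∑-concatMap g []       f = refl
  ∑-concatMap g (x ∷ xs) f = trans (∑-++ (g x) (concatMap g xs) f) (cong (_+_ (∑ (g x) f)) (∑-concatMap g xs f))

sumWhere≡∑-filterᵇ : ∀ p f (xs : List (List ℕ)) → sumWhere p f xs ≡ ∑ (filterᵇ p xs) f
sumWhere≡∑-filterᵇ p f []       = refl
sumWhere≡∑-filterᵇ p f (x ∷ xs) with p x
... | true  = cong (_+_ (f x)) (sumWhere≡∑-filterᵇ p f xs)
... | false = trans (+-identityˡ _) (sumWhere≡∑-filterᵇ p f xs)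

module _ {A : Set} where

  unique∧set⇒↭ : {xs ys : List A} → Unique xs → Unique ys → xs ∼[ set ] ys → xs ↭ ys
  unique∧set⇒↭ u v eq = ∼bag⇒↭ (unique∧set⇒bag u v eq)

module _ {A B : Set} (g : A → List B) where

  concatMap-unique : ∀ {xs} → Unique xs → (∀ {x} → x ∈ xs → Unique (g x)) →
                     (∀ {x x′ y} → x ∈ xs → x′ ∈ xs → y ∈ g x → y ∈ g x′ → x ≡ x′) →
                     Unique (concatMap g xs)
  concatMap-unique []            _      _        = []
  concatMap-unique {x ∷ xs} (x∉xs ∷ u) g-unique separated =
    Unique.++⁺ (g-unique (here refl))
               (concatMap-unique u (g-unique ∘ there) (λ p p′ → separated (there p) (there p′)))
               disjoint
    where
    disjoint : Disjoint (g x) (concatMap g xs)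
    disjoint (y∈gx , y∈rest) with find (∈-concatMap⁻ g y∈rest)
    ... | x′ , x′∈xs , y∈gx′ = All.lookup x∉xs x′∈xs (separated (here refl) (there x′∈xs) y∈gx y∈gx′)

-- Inversion sequences

IsInvSeqFrom : ℕ → List ℕ → Set
IsInvSeqFrom i []       = ⊤
IsInvSeqFrom i (x ∷ xs) = x ≤ i × IsInvSeqFrom (suc i) xs

IsInvSeq : List ℕ → Set
IsInvSeq = IsInvSeqFrom 0

IsInvSeqFrom-∷ʳ⁺ : ∀ i xs {v} → IsInvSeqFrom i xs → v ≤ i +ℕ length xs → IsInvSeqFrom i (xs ∷ʳ v)
IsInvSeqFrom-∷ʳ⁺ i []       _          v≤ = ≤-trans v≤ (≤-reflexive (+ℕ-identityʳ i)) , tt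
IsInvSeqFrom-∷ʳ⁺ i (x ∷ xs) (x≤i , inv) v≤  = x≤i , IsInvSeqFrom-∷ʳ⁺ (suc i) xs inv (≤-trans v≤ (≤-reflexive (+-suc i _)))

IsInvSeqFrom-∷ʳ⁻ : ∀ i xs {v} → IsInvSeqFrom i (xs ∷ʳ v) → IsInvSeqFrom i xs × v ≤ i +ℕ length xs
IsInvSeqFrom-∷ʳ⁻ i []       (v≤i , _)   = tt , ≤-trans v≤i (≤-reflexive (sym (+ℕ-identityʳ i)))
IsInvSeqFrom-∷ʳ⁻ i (x ∷ xs) (x≤i , inv) with IsInvSeqFrom-∷ʳ⁻ (suc i) xs inv
... | inv′ , v≤ = (x≤i , inv′) , ≤-trans v≤ (≤-reflexive (sym (+-suc i _)))

∈-invSeqs⁻ : ∀ n {s} → s ∈ invSeqs n → length s ≡ n × IsInvSeq s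
∈-invSeqs⁻ zero    {[]} _ = refl , tt
∈-invSeqs⁻ zero    {_ ∷ _} (here ())
∈-invSeqs⁻ (suc n) s∈ with find (∈-concatMap⁻ _ {xs = invSeqs n} s∈)
... | s₀ , s₀∈ , s∈ext with ∈-map⁻ (s₀ ∷ʳ_) s∈ext
... | v , v∈ , refl with ∈-invSeqs⁻ n s₀∈
... | refl , inv = length-∷ʳ s₀ , IsInvSeqFrom-∷ʳ⁺ 0 s₀ inv (s≤s⁻¹ (∈-upTo⁻ v∈))

∈-invSeqs⁺ : ∀ n {s} → length s ≡ n → IsInvSeq s → s ∈ invSeqs n
∈-invSeqs⁺ zero    {[]} _   _ = here refl
∈-invSeqs⁺ (suc n) {s} len inv with initLast s
... | s₀ ∷ʳ′ v with IsInvSeqFrom-∷ʳ⁻ 0 s₀ inv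
... | inv₀ , v≤ = ∈-concatMap⁺ _ (lose (∈-invSeqs⁺ n len₀ inv₀) (∈-map⁺ (s₀ ∷ʳ_) (∈-upTo⁺ (s≤s (≤-trans v≤ (≤-reflexive len₀))))))
  where
  len₀ : length s₀ ≡ n
  len₀ = suc-injective (trans (sym (length-∷ʳ s₀)) len)

invSeqs-unique : ∀ n → Unique (invSeqs n)
invSeqs-unique zero    = [] ∷ []
invSeqs-unique (suc n) = concatMap-unique _ (invSeqs-unique n)
  (λ {s} _ → Unique.map⁺ (∷ʳ-injectiveʳ s s) (Unique.upTo⁺ (suc n)))
  separated
  where
  separated : ∀ {s s′ y} → s ∈ invSeqs n → s′ ∈ invSeqs n → y ∈ map (s ∷ʳ_) (upTo (suc n)) → y ∈ map (s′ ∷ʳ_) (upTo (suc n)) → s ≡ s′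
  separated {s} {s′} _ _ y∈ y∈′ with ∈-map⁻ (s ∷ʳ_) y∈ | ∈-map⁻ (s′ ∷ʳ_) y∈′
  ... | _ , _ , refl | _ , _ , eq = ∷ʳ-injectiveˡ s s′ eq

-- Ascent sequences

countFrom : (ℕ → ℕ → Bool) → ℕ → List ℕ → ℕ
countFrom p i []      = 0
countFrom p i (a ∷ r) = (if p i a then 1 else 0) +ℕ countFrom p (suc i) r

-- The local functions through which Defs defines count and isAscent cannot be named from outside.
-- Each is bound below to a metavariable, solved by unification in the clause that follows once `with`
-- has turned the arguments of the unfolded local function into distinct variables.
mutual
  count-go : (ℕ → ℕ → Bool) → List ℕ → ℕ → List ℕ → ℕ
  count-go = _

  count-go≗countFrom : ∀ p s i r → count-go p s i r ≡ countFrom p i r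
  count-go≗countFrom p s i []      = refl
  count-go≗countFrom p s i (a ∷ r) = cong (_ +ℕ_) (count-go≗countFrom p s (suc i) r)

  count≡countFrom : ∀ p s → count p s ≡ countFrom p 0 s
  count≡countFrom p []      = refl
  count≡countFrom p (a ∷ r) with a ∷ r | 1
  ... | s | i = cong (_ +ℕ_) (count-go≗countFrom p s i r)

countFrom-index-free : ∀ (q : ℕ → Bool) i j r → countFrom (λ _ → q) i r ≡ countFrom (λ _ → q) j r
countFrom-index-free q i j []      = refl
countFrom-index-free q i j (x ∷ r) = cong (_ +ℕ_) (countFrom-index-free q (suc i) (suc j) r)

mutual
  isAscent-go : List ℕ → ℕ → ℕ → Bool
  isAscent-go = _

  isAscent-unfold : ∀ s → isAscent s ≡ isAscent-go s 1 (length s)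
  isAscent-unfold s with 1 | length s
  ... | k | n = refl

ascentBit : ℕ → ℕ → ℕ
ascentBit l x = if l <ᵇ x then 1 else 0

-- ascentTail c l xs: xs can follow a prefix of an ascent sequence that ends with l and has c ascents.
ascentTail : ℕ → ℕ → List ℕ → Bool
ascentTail c l []       = true
ascentTail c l (x ∷ xs) = (x ≤ᵇ suc c) ∧ ascentTail (c +ℕ ascentBit l x) x xs

ascentBit-≥ : ∀ {l x} → x ≤ l → ascentBit l x ≡ 0
ascentBit-≥ {l} {x} x≤l = if-¬T (λ l<x → <⇒≱ (<ᵇ⇒< l x l<x) x≤l)

ascentBit-suc : ∀ l → ascentBit l (suc l) ≡ 1
ascentBit-suc l = if-T (<⇒<ᵇ (n<1+n l))

ascentBit≤1 : ∀ l x → ascentBit l x ≤ 1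
ascentBit≤1 l x with l <ᵇ x
... | true  = ≤-refl
... | false = z≤n

asc-∷ʳ : ∀ xs y x → asc (xs ∷ʳ y ∷ʳ x) ≡ asc (xs ∷ʳ y) +ℕ ascentBit y x
asc-∷ʳ []            y x = +ℕ-comm (ascentBit y x) 0
asc-∷ʳ (z ∷ [])      y x = trans (cong (ascentBit z y +ℕ_) (+ℕ-comm (ascentBit y x) 0)) (sym (+ℕ-assoc (ascentBit z y) 0 _))
asc-∷ʳ (z ∷ z′ ∷ zs) y x = trans (cong (ascentBit z z′ +ℕ_) (asc-∷ʳ (z′ ∷ zs) y x)) (sym (+ℕ-assoc (ascentBit z z′) _ _))

<ᵇ-length-∷ʳ : ∀ (pre : List ℕ) y → (suc (length pre) <ᵇ length (pre ++ y ∷ [])) ≡ false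
<ᵇ-length-∷ʳ []        y = refl
<ᵇ-length-∷ʳ (_ ∷ pre) y = <ᵇ-length-∷ʳ pre y

<ᵇ-length-++ : ∀ (pre : List ℕ) y x (rest : List ℕ) → (suc (length pre) <ᵇ length (pre ++ y ∷ x ∷ rest)) ≡ true
<ᵇ-length-++ []        y x rest = refl
<ᵇ-length-++ (_ ∷ pre) y x rest = <ᵇ-length-++ pre y x rest

at-suc-length : ∀ pre y x rest → at (pre ++ y ∷ x ∷ rest) (suc (length pre)) ≡ x
at-suc-length []        y x rest = refl
at-suc-length (_ ∷ pre) y x rest = at-suc-length pre y x rest

take-suc-length : ∀ pre y (rest : List ℕ) → take (suc (length pre)) (pre ++ y ∷ rest) ≡ pre ∷ʳ y
take-suc-length []        y rest = refl
take-suc-length (z ∷ pre) y rest = cong (z ∷_) (take-suc-length pre y rest)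

isAscent-go-++ : ∀ pre y rest →
  isAscent-go (pre ++ y ∷ rest) (suc (length pre)) (suc (length rest)) ≡ ascentTail (asc (pre ∷ʳ y)) y rest
isAscent-go-++ pre y [] = cong (λ b → (if b then condition else true) ∧ true) (<ᵇ-length-∷ʳ pre y)
  where
  condition : Bool
  condition = at (pre ∷ʳ y) (suc (length pre)) ≤ᵇ suc (asc (take (suc (length pre)) (pre ∷ʳ y)))
isAscent-go-++ pre y (x ∷ rest) = begin
    (if k <ᵇ length s then condition else true) ∧ later
      ≡⟨ cong (λ b → (if b then condition else true) ∧ later) (<ᵇ-length-++ pre y x rest) ⟩
    condition ∧ later
      ≡⟨ cong₂ (λ a p → (a ≤ᵇ suc (asc p)) ∧ later) (at-suc-length pre y x rest) (take-suc-length pre y (x ∷ rest)) ⟩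
    (x ≤ᵇ suc (asc (pre ∷ʳ y))) ∧ later
      ≡⟨ cong₂ (λ s k → (x ≤ᵇ suc (asc (pre ∷ʳ y))) ∧ isAscent-go s (suc k) (suc (length rest)))
               (sym (∷ʳ-++ pre y (x ∷ rest))) (sym (length-∷ʳ pre)) ⟩
    (x ≤ᵇ suc (asc (pre ∷ʳ y))) ∧ isAscent-go ((pre ∷ʳ y) ++ x ∷ rest) (suc (length (pre ∷ʳ y))) (suc (length rest))
      ≡⟨ cong ((x ≤ᵇ suc (asc (pre ∷ʳ y))) ∧_) (isAscent-go-++ (pre ∷ʳ y) x rest) ⟩
    (x ≤ᵇ suc (asc (pre ∷ʳ y))) ∧ ascentTail (asc (pre ∷ʳ y ∷ʳ x)) x rest
      ≡⟨ cong (λ c → (x ≤ᵇ suc (asc (pre ∷ʳ y))) ∧ ascentTail c x rest) (asc-∷ʳ pre y x) ⟩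
    (x ≤ᵇ suc (asc (pre ∷ʳ y))) ∧ ascentTail (asc (pre ∷ʳ y) +ℕ ascentBit y x) x rest ∎
  where
  open ≡-Reasoning
  k : ℕ
  k = suc (length pre)
  s : List ℕ
  s = pre ++ y ∷ x ∷ rest
  condition : Bool
  condition = at s k ≤ᵇ suc (asc (take k s))
  later : Bool
  later = isAscent-go s (suc k) (suc (length rest))

isAscent-∷ : ∀ y rest → isAscent (y ∷ rest) ≡ ascentTail 0 y rest
isAscent-∷ y rest = trans (isAscent-unfold (y ∷ rest)) (isAscent-go-++ [] y rest)

range : ℕ → ℕ → List ℕ
range k zero    = []
range k (suc m) = k ∷ range (suc k) m

length-range : ∀ k m → length (range k m) ≡ m
length-range k zero    = refl
length-range k (suc m) = cong suc (length-range (suc k) m)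

∈-range⁻ : ∀ {a} k m → a ∈ range k m → k ≤ a × a < k +ℕ m
∈-range⁻ k (suc m) (here refl) = ≤-refl , m<m+n k z<s
∈-range⁻ k (suc m) (there a∈) with ∈-range⁻ (suc k) m a∈
... | k<a , a< = <⇒≤ k<a , <-≤-trans a< (≤-reflexive (sym (+-suc k m)))

∈-range⁺ : ∀ {a} k m → k ≤ a → a < k +ℕ m → a ∈ range k m
∈-range⁺ {a} k zero    k≤a a< = ⊥-elim (<⇒≱ a< (≤-trans (≤-reflexive (+ℕ-identityʳ k)) k≤a))
∈-range⁺ {a} k (suc m) k≤a a< with k ≟ a
... | yes refl = here refl
... | no  k≢a  = there (∈-range⁺ (suc k) m (≤∧≢⇒< k≤a k≢a) (<-≤-trans a< (≤-reflexive (+-suc k m))))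

range-unique : ∀ k m → Unique (range k m)
range-unique k zero    = []
range-unique k (suc m) = All.tabulate (λ a∈ → <⇒≢ (proj₁ (∈-range⁻ (suc k) m a∈))) ∷ range-unique (suc k) m

∈-range-∸⁻ : ∀ {a} b n → b ≤ n → a ∈ range b (n ∸ b) → b ≤ a × a < n
∈-range-∸⁻ b n b≤n a∈ with ∈-range⁻ b (n ∸ b) a∈
... | b≤a , a< = b≤a , <-≤-trans a< (≤-reflexive (m+[n∸m]≡n b≤n))

∈-range-∸⁺ : ∀ {a} b n → b ≤ a → a < n → a ∈ range b (n ∸ b)
∈-range-∸⁺ b n b≤a a<n = ∈-range⁺ b (n ∸ b) b≤a (<-≤-trans a<n (≤-reflexive (sym (m+[n∸m]≡n (≤-trans b≤a (<⇒≤ a<n))))))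

ascentTail-range : ∀ c m rest → ascentTail c c (range (suc c) m ++ rest) ≡ ascentTail (c +ℕ m) (c +ℕ m) rest
ascentTail-range c zero    rest = cong (λ d → ascentTail d d rest) (sym (+ℕ-identityʳ c))
ascentTail-range c (suc m) rest = begin
  (suc c ≤ᵇ suc c) ∧ ascentTail (c +ℕ ascentBit c (suc c)) (suc c) (range (suc (suc c)) m ++ rest)
    ≡⟨ ∧-T (≤⇒≤ᵇ (≤-refl {suc c})) ⟩
  ascentTail (c +ℕ ascentBit c (suc c)) (suc c) (range (suc (suc c)) m ++ rest)
    ≡⟨ cong (λ d → ascentTail d (suc c) (range (suc (suc c)) m ++ rest)) (trans (cong (c +ℕ_) (ascentBit-suc c)) (+ℕ-comm c 1)) ⟩
  ascentTail (suc c) (suc c) (range (suc (suc c)) m ++ rest)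
    ≡⟨ ascentTail-range (suc c) m rest ⟩
  ascentTail (suc c +ℕ m) (suc c +ℕ m) rest
    ≡⟨ cong (λ d → ascentTail d d rest) (sym (+-suc c m)) ⟩
  ascentTail (c +ℕ suc m) (c +ℕ suc m) rest ∎
  where open ≡-Reasoning

isAscent-range : ∀ m rest → isAscent (range 0 (suc m) ++ rest) ≡ ascentTail m m rest
isAscent-range m rest = trans (isAscent-∷ 0 (range 1 m ++ rest)) (ascentTail-range 0 m rest)

asc-range : ∀ k m rest → asc (range k (suc m) ++ rest) ≡ m +ℕ asc (k +ℕ m ∷ rest)
asc-range k zero    rest = cong (λ j → asc (j ∷ rest)) (sym (+ℕ-identityʳ k))
asc-range k (suc m) rest = begin
  ascentBit k (suc k) +ℕ asc (range (suc k) (suc m) ++ rest) ≡⟨ cong₂ _+ℕ_ (ascentBit-suc k) (asc-range (suc k) m rest) ⟩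
  suc (m +ℕ asc (suc k +ℕ m ∷ rest))                          ≡⟨ cong (λ j → suc (m +ℕ asc (j ∷ rest))) (sym (+-suc k m)) ⟩
  suc m +ℕ asc (k +ℕ suc m ∷ rest)                            ∎
  where open ≡-Reasoning

isFixed : ℕ → ℕ → Bool
isFixed j a = a ≡ᵇ j

maxs≡countFrom : ∀ s → maxs s ≡ countFrom isFixed 0 s
maxs≡countFrom = count≡countFrom isFixed

countFrom-range : ∀ k m rest → countFrom isFixed k (range k m ++ rest) ≡ m +ℕ countFrom isFixed (k +ℕ m) rest
countFrom-range k zero    rest = cong (λ j → countFrom isFixed j rest) (sym (+ℕ-identityʳ k))
countFrom-range k (suc m) rest = begin
  (if k ≡ᵇ k then 1 else 0) +ℕ countFrom isFixed (suc k) (range (suc k) m ++ rest)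
    ≡⟨ cong₂ _+ℕ_ (if-T (≡⇒≡ᵇ k k refl)) (countFrom-range (suc k) m rest) ⟩
  suc (m +ℕ countFrom isFixed (suc k +ℕ m) rest)
    ≡⟨ cong (λ j → suc (m +ℕ countFrom isFixed j rest)) (sym (+-suc k m)) ⟩
  suc m +ℕ countFrom isFixed (k +ℕ suc m) rest ∎
  where open ≡-Reasoning

-- An ascent tail after c ascents takes values ≤ c + 1 while the position keeps growing.
countFrom-ascentTail : ∀ {c l i} r → suc (suc c) ≤ i → T (ascentTail c l r) → countFrom isFixed i r ≡ 0
countFrom-ascentTail []      _      _    = refl
countFrom-ascentTail {c} {l} {i} (x ∷ r) c+2≤i tail with Equivalence.to T-∧ tail
... | x≤c+1 , tail′ = trans (cong (_+ℕ countFrom isFixed (suc i) r) (if-¬T x≢i))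
                            (countFrom-ascentTail r (s≤s c′+1≤i) tail′)
  where
  x≢i : ¬ T (x ≡ᵇ i)
  x≢i x≡i = <⇒≢ (≤-trans (s≤s (≤ᵇ⇒≤ x (suc c) x≤c+1)) c+2≤i) (≡ᵇ⇒≡ x i x≡i)
  c′+1≤i : suc (c +ℕ ascentBit l x) ≤ i
  c′+1≤i = ≤-trans (s≤s (≤-trans (+-monoʳ-≤ c (ascentBit≤1 l x)) (≤-reflexive (+ℕ-comm c 1)))) c+2≤i

ascentTail⇒IsInvSeqFrom : ∀ {c l i} r → c < i → T (ascentTail c l r) → IsInvSeqFrom i r
ascentTail⇒IsInvSeqFrom []      _   _    = tt
ascentTail⇒IsInvSeqFrom {c} {l} {i} (x ∷ r) c<i tail with Equivalence.to T-∧ tail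
... | x≤c+1 , tail′ = ≤-trans (≤ᵇ⇒≤ x (suc c) x≤c+1) c<i , ascentTail⇒IsInvSeqFrom r c′<i+1 tail′
  where
  c′<i+1 : c +ℕ ascentBit l x < suc i
  c′<i+1 = s≤s (≤-trans (≤-trans (+-monoʳ-≤ c (ascentBit≤1 l x)) (≤-reflexive (+ℕ-comm c 1))) c<i)

ascent⇒IsInvSeq : ∀ xs → T (isAscent (0 ∷ xs)) → IsInvSeq (0 ∷ xs)
ascent⇒IsInvSeq xs asc = z≤n , ascentTail⇒IsInvSeqFrom xs z<s (subst T (isAscent-∷ 0 xs) asc)

ascentTail-∷ : ∀ {c l x} r → x ≤ l → x ≤ suc c → ascentTail c l (x ∷ r) ≡ ascentTail c x r
ascentTail-∷ {c} {l} {x} r x≤l x≤c+1 = begin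
  (x ≤ᵇ suc c) ∧ ascentTail (c +ℕ ascentBit l x) x r ≡⟨ ∧-T (≤⇒≤ᵇ x≤c+1) ⟩
  ascentTail (c +ℕ ascentBit l x) x r                ≡⟨ cong (λ d → ascentTail d x r) (trans (cong (c +ℕ_) (ascentBit-≥ x≤l)) (+ℕ-identityʳ c)) ⟩
  ascentTail c x r                                   ∎
  where open ≡-Reasoning

maxs-range-++ : ∀ m rest → maxs (range 0 m ++ rest) ≡ m +ℕ countFrom isFixed m rest
maxs-range-++ m rest = trans (maxs≡countFrom (range 0 m ++ rest)) (countFrom-range 0 m rest)

at-range-++ : ∀ k m ys j → at (range k m ++ ys) (m +ℕ j) ≡ at ys j
at-range-++ k zero    ys j = refl
at-range-++ k (suc m) ys j = at-range-++ (suc k) m ys j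

length-range-++ : ∀ k m (ys : List ℕ) → length (range k m ++ ys) ≡ m +ℕ length ys
length-range-++ k m ys = trans (length-++ (range k m)) (cong (_+ℕ length ys) (length-range k m))

-- The sequences of F and 𝒮₂

data FShape : List ℕ → Set where
  fShape : ∀ {m b r} → b ≤ m → T (ascentTail m b r) → FShape (range 0 (suc m) ++ b ∷ r)

module _ {m b r} (b≤m : b ≤ m) (tail : T (ascentTail m b r)) where

  private
    s : List ℕ
    s = range 0 (suc m) ++ b ∷ r

  isAscent-fShape : isAscent s ≡ ascentTail m b r
  isAscent-fShape = trans (isAscent-range m (b ∷ r)) (ascentTail-∷ r b≤m (m≤n⇒m≤1+n b≤m))

  maxs-fShape : maxs s ≡ suc m
  maxs-fShape = begin
    maxs s                                                                   ≡⟨ maxs-range-++ (suc m) (b ∷ r) ⟩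
    suc m +ℕ ((if b ≡ᵇ suc m then 1 else 0) +ℕ countFrom isFixed (suc (suc m)) r)
      ≡⟨ cong₂ (λ i j → suc m +ℕ (i +ℕ j)) (if-¬T (λ b≡ → <⇒≢ (s≤s b≤m) (≡ᵇ⇒≡ b (suc m) b≡))) (countFrom-ascentTail r ≤-refl tail) ⟩
    suc m +ℕ 0                                                                ≡⟨ +ℕ-identityʳ (suc m) ⟩
    suc m                                                                     ∎
    where open ≡-Reasoning

  ealm-fShape : ealm s ≡ b
  ealm-fShape = trans (cong (at s) (trans maxs-fShape (sym (+ℕ-identityʳ (suc m))))) (at-range-++ 0 (suc m) (b ∷ r) 0)

  at-suc-maxs-fShape : at s (suc (maxs s)) ≡ at r 0
  at-suc-maxs-fShape = trans (cong (λ i → at s (suc i)) maxs-fShape)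
                             (trans (cong (at s) (sym (+ℕ-comm (suc m) 1))) (at-range-++ 0 (suc m) (b ∷ r) 1))

  inF-fShape : T (inF s)
  inF-fShape = Equivalence.from T-∧ (subst T (sym isAscent-fShape) tail , Equivalence.from T-∧ (tt , <⇒<ᵇ max<len))
    where
    max<len : maxs s < length s
    max<len = subst₂ _<_ (sym maxs-fShape) (sym (length-range-++ 0 (suc m) (b ∷ r))) (m<m+n (suc m) z<s)

  fShape-IsInvSeq : IsInvSeq s
  fShape-IsInvSeq = ascent⇒IsInvSeq (range 1 m ++ b ∷ r) (subst T (sym isAscent-fShape) tail)

HeadIsNot : ℕ → List ℕ → Set
HeadIsNot n []      = ⊤
HeadIsNot n (x ∷ _) = x ≢ n

data RampSplit (k : ℕ) : List ℕ → Set where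
  split : ∀ m r → HeadIsNot (k +ℕ m) r → RampSplit k (range k m ++ r)

rampSplit : ∀ k xs → RampSplit k xs
rampSplit k []       = split 0 [] tt
rampSplit k (x ∷ xs) with x ≟ k
... | no x≢k = split 0 (x ∷ xs) (λ x≡ → x≢k (trans x≡ (+ℕ-identityʳ k)))
... | yes refl with rampSplit (suc x) xs
...   | split m r head≢ = split (suc m) r (subst (λ n → HeadIsNot n r) (sym (+-suc x m)) head≢)

toFShape : ∀ xs → T (isAscent (0 ∷ xs)) → maxs (0 ∷ xs) < length (0 ∷ xs) → FShape (0 ∷ xs)
toFShape xs asc max< with rampSplit 1 xs
... | split m [] _ = ⊥-elim (<-irrefl (trans (maxs-range-++ (suc m) []) (sym (length-range-++ 0 (suc m) []))) max<)
... | split m (b ∷ r) b≢m+1 with Equivalence.to T-∧ (subst T (isAscent-range m (b ∷ r)) asc)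
...   | b≤m+1 , tail = fShape b≤m (subst T (cong (λ c → ascentTail c b r) c≡m) tail)
  where
  b≤m : b ≤ m
  b≤m = s≤s⁻¹ (≤∧≢⇒< (≤ᵇ⇒≤ b (suc m) b≤m+1) b≢m+1)
  c≡m : m +ℕ ascentBit m b ≡ m
  c≡m = trans (cong (m +ℕ_) (ascentBit-≥ b≤m)) (+ℕ-identityʳ m)

data S2Shape : List ℕ → Set where
  s2Shape : ∀ {m a b r} → b ≤ a → a ≤ m → T (ascentTail m b r) → S2Shape (range 0 (suc m) ++ a ∷ b ∷ r)

ascentTail-descent : ∀ {m a b} r → b ≤ a → a ≤ m → ascentTail m a (b ∷ r) ≡ ascentTail m b r
ascentTail-descent r b≤a a≤m = ascentTail-∷ r b≤a (m≤n⇒m≤1+n (≤-trans b≤a a≤m))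

module _ {m a b r} (b≤a : b ≤ a) (a≤m : a ≤ m) (tail : T (ascentTail m b r)) where

  private
    s : List ℕ
    s = range 0 (suc m) ++ a ∷ b ∷ r

  s2Shape-tail : T (ascentTail m a (b ∷ r))
  s2Shape-tail = subst T (sym (ascentTail-descent r b≤a a≤m)) tail

  inS2-s2Shape : T (inS2 s)
  inS2-s2Shape = Equivalence.from T-∧ (subst T (sym (isAscent-fShape a≤m s2Shape-tail)) s2Shape-tail ,
                 Equivalence.from T-∧ (≤⇒≤ᵇ long , subst T (sym b≤ᵇa) (≤⇒≤ᵇ b≤a)))
    where
    long : suc (suc (maxs s)) ≤ length s
    long = subst₂ _≤_ (cong (suc ∘ suc) (sym (maxs-fShape a≤m s2Shape-tail))) (sym (length-range-++ 0 (suc m) (a ∷ b ∷ r)))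
                  (≤-trans (≤-reflexive (+ℕ-comm 2 (suc m))) (+-monoʳ-≤ (suc m) (s≤s (s≤s z≤n))))
    b≤ᵇa : (at s (suc (maxs s)) ≤ᵇ at s (maxs s)) ≡ (b ≤ᵇ a)
    b≤ᵇa = cong₂ _≤ᵇ_ (at-suc-maxs-fShape a≤m s2Shape-tail) (ealm-fShape a≤m s2Shape-tail)

toS2Shape : ∀ xs → T (inS2 (0 ∷ xs)) → S2Shape (0 ∷ xs)
toS2Shape xs inS2-s with Equivalence.to T-∧ inS2-s
... | asc , rest with Equivalence.to T-∧ rest
... | long , descent with toFShape xs asc (≤-trans (n≤1+n _) (≤ᵇ⇒≤ _ _ long))
...   | fShape {m} {a} {[]} a≤m tail =
        ⊥-elim (<-irrefl refl (≤-trans (subst₂ _≤_ (cong (suc ∘ suc) (maxs-fShape a≤m tail)) (length-range-++ 0 (suc m) (a ∷ []))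
                                                    (≤ᵇ⇒≤ _ _ long))
                                       (≤-reflexive (+ℕ-comm (suc m) 1))))
...   | fShape {m} {a} {b ∷ r} a≤m tail = s2Shape b≤a a≤m (subst T (ascentTail-descent r b≤a a≤m) tail)
  where
  b≤a : b ≤ a
  b≤a = ≤ᵇ⇒≤ b a (subst T (cong₂ _≤ᵇ_ (at-suc-maxs-fShape a≤m tail) (ealm-fShape a≤m tail)) descent)

-- Insertion after the initial run

zeroBit : ℕ → ℕ
zeroBit a = if a ≡ᵇ 0 then 1 else 0

zeros-insert : ∀ xs a ys → zeros (xs ++ a ∷ ys) ≡ zeroBit a +ℕ zeros (xs ++ ys)
zeros-insert xs a ys = begin
  zeros (xs ++ a ∷ ys)                                 ≡⟨ count≡countFrom _ (xs ++ a ∷ ys) ⟩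
  countFrom (λ _ → _≡ᵇ 0) 0 (xs ++ a ∷ ys)             ≡⟨ countFrom-insert 0 xs ⟩
  zeroBit a +ℕ countFrom (λ _ → _≡ᵇ 0) 0 (xs ++ ys)    ≡⟨ cong (zeroBit a +ℕ_) (sym (count≡countFrom _ (xs ++ ys))) ⟩
  zeroBit a +ℕ zeros (xs ++ ys)                        ∎
  where
  open ≡-Reasoning
  countFrom-insert : ∀ i xs → countFrom (λ _ → _≡ᵇ 0) i (xs ++ a ∷ ys) ≡ zeroBit a +ℕ countFrom (λ _ → _≡ᵇ 0) i (xs ++ ys)
  countFrom-insert i []       = cong (zeroBit a +ℕ_) (countFrom-index-free (_≡ᵇ 0) (suc i) i ys)
  countFrom-insert i (x ∷ xs) = trans (cong (zeroBit x +ℕ_) (countFrom-insert (suc i) xs)) (+ℕ-left-comm (zeroBit x) (zeroBit a) _)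

∈-insert-repeat : ∀ {A : Set} {a : A} xs {ys} → a ∈ xs ++ ys → (xs ++ a ∷ ys) ∼[ set ] (xs ++ ys)
∈-insert-repeat {a = a} xs {ys} a∈ = mk⇔ to from
  where
  to : ∀ {z} → z ∈ xs ++ a ∷ ys → z ∈ xs ++ ys
  to z∈ with ∈-++⁻ xs z∈
  ... | inj₁ z∈xs         = ∈-++⁺ˡ z∈xs
  ... | inj₂ (here refl)  = a∈
  ... | inj₂ (there z∈ys) = ∈-++⁺ʳ xs z∈ys
  from : ∀ {z} → z ∈ xs ++ ys → z ∈ xs ++ a ∷ ys
  from z∈ with ∈-++⁻ xs z∈
  ... | inj₁ z∈xs = ∈-++⁺ˡ z∈xs
  ... | inj₂ z∈ys = ∈-++⁺ʳ xs (there z∈ys)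

length-deduplicate-cong : ∀ {xs ys} → xs ∼[ set ] ys → length (deduplicate _≟_ xs) ≡ length (deduplicate _≟_ ys)
length-deduplicate-cong {xs} {ys} xs≈ys = ↭-length (unique∧set⇒↭ (deduplicate-! xs) (deduplicate-! ys) dedup≈)
  where
  dedup≈ : deduplicate _≟_ xs ∼[ set ] deduplicate _≟_ ys
  dedup≈ = mk⇔ (∈-deduplicate⁺ _≟_ ∘ Equivalence.to xs≈ys ∘ ∈-deduplicate⁻ _≟_ xs)
               (∈-deduplicate⁺ _≟_ ∘ Equivalence.from xs≈ys ∘ ∈-deduplicate⁻ _≟_ ys)

rep-insert-repeat : ∀ {a} xs ys → a ∈ xs ++ ys → rep (xs ++ a ∷ ys) ≡ suc (rep (xs ++ ys))
rep-insert-repeat xs ys a∈ = begin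
  length (xs ++ _ ∷ ys) ∸ length (deduplicate _≟_ (xs ++ _ ∷ ys))
    ≡⟨ cong₂ _∸_ (length-++-sucʳ xs _ ys) (length-deduplicate-cong (∈-insert-repeat xs a∈)) ⟩
  suc (length (xs ++ ys)) ∸ length (deduplicate _≟_ (xs ++ ys))
    ≡⟨ +-∸-assoc 1 (length-deduplicate _≟_ (xs ++ ys)) ⟩
  suc (rep (xs ++ ys)) ∎
  where open ≡-Reasoning

asc-insert : ∀ {m a b} r → b ≤ a → a ≤ m → asc (range 0 (suc m) ++ a ∷ b ∷ r) ≡ asc (range 0 (suc m) ++ b ∷ r)
asc-insert {m} {a} {b} r b≤a a≤m = begin
  asc (range 0 (suc m) ++ a ∷ b ∷ r)                     ≡⟨ asc-range 0 m (a ∷ b ∷ r) ⟩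
  m +ℕ (ascentBit m a +ℕ (ascentBit a b +ℕ asc (b ∷ r))) ≡⟨ cong₂ (λ i j → m +ℕ (i +ℕ (j +ℕ asc (b ∷ r)))) (ascentBit-≥ a≤m) (ascentBit-≥ b≤a) ⟩
  m +ℕ asc (b ∷ r)                                       ≡⟨ cong (λ i → m +ℕ (i +ℕ asc (b ∷ r))) (sym (ascentBit-≥ (≤-trans b≤a a≤m))) ⟩
  m +ℕ (ascentBit m b +ℕ asc (b ∷ r))                    ≡⟨ sym (asc-range 0 m (b ∷ r)) ⟩
  asc (range 0 (suc m) ++ b ∷ r)                         ∎
  where open ≡-Reasoning

insertAt : ℕ → ℕ → List ℕ → List ℕ
insertAt i a s = take i s ++ a ∷ drop i s

removeAt : ℕ → List ℕ → List ℕ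
removeAt i s = take i s ++ drop (suc i) s

insertAt-++ : ∀ xs a ys → insertAt (length xs) a (xs ++ ys) ≡ xs ++ a ∷ ys
insertAt-++ []       a ys = refl
insertAt-++ (x ∷ xs) a ys = cong (x ∷_) (insertAt-++ xs a ys)

removeAt-++ : ∀ xs a ys → removeAt (length xs) (xs ++ a ∷ ys) ≡ xs ++ ys
removeAt-++ []       a ys = refl
removeAt-++ (x ∷ xs) a ys = cong (x ∷_) (removeAt-++ xs a ys)

insertions : List ℕ → List (List ℕ)
insertions s = map (λ a → insertAt (maxs s) a s) (range (ealm s) (maxs s ∸ ealm s))

module _ {m b r} (b≤m : b ≤ m) (tail : T (ascentTail m b r)) where

  private
    s : List ℕ
    s = range 0 (suc m) ++ b ∷ r
    insert : ℕ → List ℕ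
    insert a = range 0 (suc m) ++ a ∷ b ∷ r

  insertions-fShape : insertions s ≡ map insert (range b (suc m ∸ b))
  insertions-fShape = begin
    map (λ a → insertAt (maxs s) a s) (range (ealm s) (maxs s ∸ ealm s))
      ≡⟨ cong₂ (λ p e → map (λ a → insertAt p a s) (range e (p ∸ e))) (maxs-fShape b≤m tail) (ealm-fShape b≤m tail) ⟩
    map (λ a → insertAt (suc m) a s) (range b (suc m ∸ b))
      ≡⟨ map-cong (λ a → subst (λ p → insertAt p a s ≡ insert a) (length-range 0 (suc m)) (insertAt-++ (range 0 (suc m)) a (b ∷ r))) _ ⟩
    map insert (range b (suc m ∸ b)) ∎
    where open ≡-Reasoning

  ∈-insertions⁻ : ∀ {y} → y ∈ insertions s → ∃ λ a → b ≤ a × a ≤ m × y ≡ insert a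
  ∈-insertions⁻ {y} y∈ with ∈-map⁻ insert (subst (y ∈_) insertions-fShape y∈)
  ... | a , a∈ , refl with ∈-range-∸⁻ b (suc m) (m≤n⇒m≤1+n b≤m) a∈
  ...   | b≤a , a<m+1 = a , b≤a , s≤s⁻¹ a<m+1 , refl

  ∈-insertions⁺ : ∀ {a} → b ≤ a → a ≤ m → insert a ∈ insertions s
  ∈-insertions⁺ {a} b≤a a≤m = subst (insert a ∈_) (sym insertions-fShape) (∈-map⁺ insert (∈-range-∸⁺ b (suc m) b≤a (s≤s a≤m)))

  insertions-unique : Unique (insertions s)
  insertions-unique = subst Unique (sym insertions-fShape)
    (Unique.map⁺ (λ eq → ∷-injectiveˡ (++-cancelˡ (range 0 (suc m)) _ _ eq)) (range-unique b (suc m ∸ b)))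

  removeAt-insertions : ∀ {y} → y ∈ insertions s → removeAt (maxs y) y ≡ s
  removeAt-insertions y∈ with ∈-insertions⁻ y∈
  ... | a , b≤a , a≤m , refl = begin
    removeAt (maxs (insert a)) (insert a)           ≡⟨ cong (λ i → removeAt i (insert a)) (maxs-fShape a≤m (s2Shape-tail {r = r} b≤a a≤m tail)) ⟩
    removeAt (suc m) (insert a)                     ≡⟨ subst (λ p → removeAt p (insert a) ≡ s) (length-range 0 (suc m)) (removeAt-++ (range 0 (suc m)) a (b ∷ r)) ⟩
    s                                               ∎
    where open ≡-Reasoning

∈-filter-inF⇒FShape : ∀ n {s} → s ∈ filterᵇ inF (invSeqs n) → FShape s
∈-filter-inF⇒FShape n {s} s∈ with ∈-filterᵇ⁻ inF (invSeqs n) s∈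
∈-filter-inF⇒FShape n {[]}     s∈ | _ , ()
∈-filter-inF⇒FShape n {x ∷ xs} s∈ | s∈inv , inF-s with ∈-invSeqs⁻ n s∈inv
... | _ , z≤n , _ with Equivalence.to (T-∧ {isAscent (0 ∷ xs)}) inF-s
...   | asc , rest = toFShape xs asc (<ᵇ⇒< _ _ (proj₂ (Equivalence.to (T-∧ {1 ≤ᵇ length (0 ∷ xs)}) rest)))

∈-filter-inS2⇒S2Shape : ∀ n {s} → s ∈ filterᵇ inS2 (invSeqs n) → S2Shape s
∈-filter-inS2⇒S2Shape n {s} s∈ with ∈-filterᵇ⁻ inS2 (invSeqs n) s∈
∈-filter-inS2⇒S2Shape n {[]}     s∈ | _ , ()
∈-filter-inS2⇒S2Shape n {x ∷ xs} s∈ | s∈inv , inS2-s with ∈-invSeqs⁻ n s∈inv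
... | _ , z≤n , _ = toS2Shape xs inS2-s

module _ (n : ℕ) where

  private
    Fs S2s : List (List ℕ)
    Fs  = filterᵇ inF (invSeqs n)
    S2s = filterᵇ inS2 (invSeqs (suc n))

  S2⊆insertions : ∀ {y} → y ∈ S2s → y ∈ concatMap insertions Fs
  S2⊆insertions y∈ with ∈-filter-inS2⇒S2Shape (suc n) y∈ | proj₁ (∈-invSeqs⁻ (suc n) (proj₁ (∈-filterᵇ⁻ inS2 (invSeqs (suc n)) y∈)))
  ... | s2Shape {m} {a} {b} {r} b≤a a≤m tail | len = ∈-concatMap⁺ insertions (lose s∈ (∈-insertions⁺ b≤m tail b≤a a≤m))
    where
    b≤m : b ≤ m
    b≤m = ≤-trans b≤a a≤m
    s∈ : range 0 (suc m) ++ b ∷ r ∈ Fs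
    s∈ = ∈-filterᵇ⁺ inF (invSeqs n)
           (∈-invSeqs⁺ n (suc-injective (trans (sym (length-++-sucʳ (range 0 (suc m)) a (b ∷ r))) len)) (fShape-IsInvSeq b≤m tail))
           (inF-fShape b≤m tail)

  insertions⊆S2 : ∀ {y} → y ∈ concatMap insertions Fs → y ∈ S2s
  insertions⊆S2 y∈ with find (∈-concatMap⁻ insertions {xs = Fs} y∈)
  ... | s , s∈ , y∈ins with ∈-filter-inF⇒FShape n s∈ | proj₁ (∈-invSeqs⁻ n (proj₁ (∈-filterᵇ⁻ inF (invSeqs n) s∈)))
  ...   | fShape {m} {b} {r} b≤m tail | len with ∈-insertions⁻ b≤m tail y∈ins
  ...     | a , b≤a , a≤m , refl = ∈-filterᵇ⁺ inS2 (invSeqs (suc n))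
            (∈-invSeqs⁺ (suc n) (trans (length-++-sucʳ (range 0 (suc m)) a (b ∷ r)) (cong suc len))
                        (fShape-IsInvSeq a≤m (s2Shape-tail {r = r} b≤a a≤m tail)))
            (inS2-s2Shape b≤a a≤m tail)

  insertions-concat-unique : Unique (concatMap insertions Fs)
  insertions-concat-unique = concatMap-unique insertions (Unique.filter⁺ (T? ∘ inF) (invSeqs-unique n)) unique separated
    where
    unique : ∀ {s} → s ∈ Fs → Unique (insertions s)
    unique s∈ with ∈-filter-inF⇒FShape n s∈
    ... | fShape b≤m tail = insertions-unique b≤m tail
    separated : ∀ {s s′ y} → s ∈ Fs → s′ ∈ Fs → y ∈ insertions s → y ∈ insertions s′ → s ≡ s′
    separated s∈ s′∈ y∈ y∈′ with ∈-filter-inF⇒FShape n s∈ | ∈-filter-inF⇒FShape n s′∈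
    ... | fShape b≤m tail | fShape b′≤m′ tail′ =
      trans (sym (removeAt-insertions b≤m tail y∈)) (removeAt-insertions b′≤m′ tail′ y∈′)

  S2-↭-insertions : S2s ↭ concatMap insertions Fs
  S2-↭-insertions = unique∧set⇒↭ (Unique.filter⁺ (T? ∘ inS2) (invSeqs-unique (suc n))) insertions-concat-unique
                                 (mk⇔ S2⊆insertions insertions⊆S2)

-- Weights

^-distribʳ-* : ∀ a b n → (a * b) ^ n ≡ a ^ n * b ^ n
^-distribʳ-* a b zero    = refl
^-distribʳ-* a b (suc n) = trans (cong (a * b *_) (^-distribʳ-* a b n)) (interchange a b _ _)
  where
  interchange : ∀ a b c d → a * b * (c * d) ≡ a * c * (b * d)
  interchange = solve-∀

geometric : ∀ w b k → (1ℤ - w) * (∑[ a ∈ range b k ] w ^ a) ≡ w ^ b - w ^ (b +ℕ k)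
geometric w b zero    = trans (*-zeroʳ (1ℤ - w)) (sym (trans (cong (λ e → w ^ b - w ^ e) (+ℕ-identityʳ b)) (+-inverseʳ (w ^ b))))
geometric w b (suc k) = begin
  (1ℤ - w) * (w ^ b + (∑[ a ∈ range (suc b) k ] w ^ a))          ≡⟨ *-distribˡ-+ (1ℤ - w) (w ^ b) _ ⟩
  (1ℤ - w) * w ^ b + (1ℤ - w) * (∑[ a ∈ range (suc b) k ] w ^ a) ≡⟨ cong (_+_ ((1ℤ - w) * w ^ b)) (geometric w (suc b) k) ⟩
  (1ℤ - w) * w ^ b + (w * w ^ b - w ^ (suc b +ℕ k))             ≡⟨ telescope w (w ^ b) _ ⟩
  w ^ b - w ^ (suc b +ℕ k)                                       ≡⟨ cong (λ e → w ^ b - w ^ e) (sym (+-suc b k)) ⟩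
  w ^ b - w ^ (b +ℕ suc k)                                       ∎
  where
  open ≡-Reasoning
  telescope : ∀ w W V → (1ℤ - w) * W + (w * W - V) ≡ W - V
  telescope = solve-∀

module _ (w z : ℤ) where

  valueWeight : ℕ → ℤ
  valueWeight a = w ^ a * z ^ zeroBit a

  ∑-valueWeight-positive : ∀ b k → ∑ (range (suc b) k) valueWeight ≡ ∑[ a ∈ range (suc b) k ] w ^ a
  ∑-valueWeight-positive b zero    = refl
  ∑-valueWeight-positive b (suc k) = cong₂ _+_ (*-identityʳ (w ^ suc b)) (∑-valueWeight-positive (suc b) k)

  ∑-valueWeight : ∀ b k → ∑ (range b (suc k)) valueWeight ≡ (∑[ a ∈ range b (suc k) ] w ^ a) + (z - 1ℤ) * 0ℤ ^ b
  ∑-valueWeight zero    k = trans (cong (_+_ (1ℤ * (z * 1ℤ))) (∑-valueWeight-positive 0 k)) (shift z _)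
    where
    shift : ∀ z S → 1ℤ * (z * 1ℤ) + S ≡ 1ℤ + S + (z - 1ℤ) * 1ℤ
    shift = solve-∀
  ∑-valueWeight (suc b) k = trans (∑-valueWeight-positive b (suc k)) (vanish z _ (0ℤ ^ b))
    where
    vanish : ∀ z S Y → S ≡ S + (z - 1ℤ) * (0ℤ * Y)
    vanish = solve-∀

  geometric-valueWeight : ∀ b k → (1ℤ - w) * ∑ (range b (suc k)) valueWeight
                                  ≡ w ^ b - w ^ (b +ℕ suc k) + (1ℤ - w) * ((z - 1ℤ) * 0ℤ ^ b)
  geometric-valueWeight b k = begin
    (1ℤ - w) * ∑ (range b (suc k)) valueWeight
      ≡⟨ cong ((1ℤ - w) *_) (∑-valueWeight b k) ⟩
    (1ℤ - w) * ((∑[ a ∈ range b (suc k) ] w ^ a) + (z - 1ℤ) * 0ℤ ^ b)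
      ≡⟨ *-distribˡ-+ (1ℤ - w) _ _ ⟩
    (1ℤ - w) * (∑[ a ∈ range b (suc k) ] w ^ a) + (1ℤ - w) * ((z - 1ℤ) * 0ℤ ^ b)
      ≡⟨ cong (_+ (1ℤ - w) * ((z - 1ℤ) * 0ℤ ^ b)) (geometric w b (suc k)) ⟩
    w ^ b - w ^ (b +ℕ suc k) + (1ℤ - w) * ((z - 1ℤ) * 0ℤ ^ b) ∎
    where open ≡-Reasoning

module _ (x q u z : ℤ) where

  baseWeight : List ℕ → ℤ
  baseWeight s = x ^ rep s * q ^ maxs s * u ^ asc s * z ^ zeros s

  wt-by-statistics : ∀ w s {R M E A Z} → rep s ≡ R → maxs s ≡ M → ealm s ≡ E → asc s ≡ A → zeros s ≡ Z →
                     wt x q w u z s ≡ x ^ R * q ^ M * w ^ E * u ^ A * z ^ Z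
  wt-by-statistics w s refl refl refl refl refl = refl

  wt-baseWeight : ∀ w s → wt x q w u z s ≡ baseWeight s * w ^ ealm s
  wt-baseWeight w s = reorder (x ^ rep s) (q ^ maxs s) (w ^ ealm s) (u ^ asc s) (z ^ zeros s)
    where
    reorder : ∀ X Q W U Z → X * Q * W * U * Z ≡ X * Q * U * Z * W
    reorder = solve-∀

  wt-q*w : ∀ w s → wt x (q * w) 1ℤ u z s ≡ baseWeight s * w ^ maxs s
  wt-q*w w s = trans (cong₂ (λ Q E → x ^ rep s * Q * E * u ^ asc s * z ^ zeros s) (^-distribʳ-* q w (maxs s)) (^-zeroˡ (ealm s)))
                     (reorder (x ^ rep s) (q ^ maxs s) (w ^ maxs s) (u ^ asc s) (z ^ zeros s))
    where
    reorder : ∀ X Q W U Z → X * (Q * W) * 1ℤ * U * Z ≡ X * Q * U * Z * W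
    reorder = solve-∀

  wt-insert : ∀ w {m a b r} → b ≤ a → a ≤ m → T (ascentTail m b r) →
              wt x q w u z (range 0 (suc m) ++ a ∷ b ∷ r) ≡ x * baseWeight (range 0 (suc m) ++ b ∷ r) * valueWeight w z a
  wt-insert w {m} {a} {b} {r} b≤a a≤m tail = begin
    wt x q w u z (range 0 (suc m) ++ a ∷ b ∷ r)
      ≡⟨ wt-by-statistics w (range 0 (suc m) ++ a ∷ b ∷ r) (rep-insert-repeat (range 0 (suc m)) (b ∷ r) (∈-++⁺ˡ (∈-range⁺ 0 (suc m) z≤n (s≤s a≤m))))
                            (trans (maxs-fShape {r = b ∷ r} a≤m tail′) (sym (maxs-fShape (≤-trans b≤a a≤m) tail)))
                            (ealm-fShape {r = b ∷ r} a≤m tail′) (asc-insert r b≤a a≤m) (zeros-insert (range 0 (suc m)) a (b ∷ r)) ⟩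
    x * x ^ rep s * q ^ maxs s * w ^ a * u ^ asc s * z ^ (zeroBit a +ℕ zeros s)
      ≡⟨ cong (x * x ^ rep s * q ^ maxs s * w ^ a * u ^ asc s *_) (^-distribˡ-+-* z (zeroBit a) (zeros s)) ⟩
    x * x ^ rep s * q ^ maxs s * w ^ a * u ^ asc s * (z ^ zeroBit a * z ^ zeros s)
      ≡⟨ reorder x (x ^ rep s) (q ^ maxs s) (w ^ a) (u ^ asc s) (z ^ zeroBit a) (z ^ zeros s) ⟩
    x * baseWeight s * valueWeight w z a ∎
    where
    open ≡-Reasoning
    s : List ℕ
    s = range 0 (suc m) ++ b ∷ r
    tail′ : T (ascentTail m a (b ∷ r))
    tail′ = s2Shape-tail {r = r} b≤a a≤m tail
    reorder : ∀ x X Q W U Z₀ Z → x * X * Q * W * U * (Z₀ * Z) ≡ x * (X * Q * U * Z) * (W * Z₀)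
    reorder = solve-∀

  ∑-insertions : ∀ w {m b r} → b ≤ m → T (ascentTail m b r) →
                 ∑ (insertions (range 0 (suc m) ++ b ∷ r)) (wt x q w u z)
                 ≡ x * baseWeight (range 0 (suc m) ++ b ∷ r) * ∑ (range b (suc (m ∸ b))) (valueWeight w z)
  ∑-insertions w {m} {b} {r} b≤m tail = begin
    ∑ (insertions s) (wt x q w u z)
      ≡⟨ cong (λ L → ∑ L (wt x q w u z)) (insertions-fShape b≤m tail) ⟩
    ∑ (map insert (range b (suc m ∸ b))) (wt x q w u z)
      ≡⟨ ∑-map insert (range b (suc m ∸ b)) (wt x q w u z) ⟩
    ∑[ a ∈ range b (suc m ∸ b) ] wt x q w u z (insert a)
      ≡⟨ ∑-cong term ⟩
    ∑[ a ∈ range b (suc m ∸ b) ] x * baseWeight s * valueWeight w z a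
      ≡⟨ ∑-*ˡ (range b (suc m ∸ b)) (x * baseWeight s) (valueWeight w z) ⟩
    x * baseWeight s * ∑ (range b (suc m ∸ b)) (valueWeight w z)
      ≡⟨ cong (λ k → x * baseWeight s * ∑ (range b k) (valueWeight w z)) (+-∸-assoc 1 b≤m) ⟩
    x * baseWeight s * ∑ (range b (suc (m ∸ b))) (valueWeight w z) ∎
    where
    open ≡-Reasoning
    s : List ℕ
    s = range 0 (suc m) ++ b ∷ r
    insert : ℕ → List ℕ
    insert a = range 0 (suc m) ++ a ∷ b ∷ r
    term : ∀ {a} → a ∈ range b (suc m ∸ b) → wt x q w u z (insert a) ≡ x * baseWeight s * valueWeight w z a
    term a∈ with ∈-range-∸⁻ b (suc m) (m≤n⇒m≤1+n b≤m) a∈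
    ... | b≤a , a<m+1 = wt-insert w b≤a (s≤s⁻¹ a<m+1) tail

  insertions-weight : ∀ w {s} → FShape s →
    (1ℤ - w) * ∑ (insertions s) (wt x q w u z)
    ≡ x * (wt x q w u z s - wt x (q * w) 1ℤ u z s) + (1ℤ - w) * (x * ((z - 1ℤ) * wt x q 0ℤ u z s))
  insertions-weight w (fShape {m} {b} {r} b≤m tail) = begin
    (1ℤ - w) * ∑ (insertions s) (wt x q w u z)
      ≡⟨ cong ((1ℤ - w) *_) (∑-insertions w b≤m tail) ⟩
    (1ℤ - w) * (x * B * ∑ (range b (suc (m ∸ b))) (valueWeight w z))
      ≡⟨ *-left-comm (1ℤ - w) (x * B) _ ⟩
    x * B * ((1ℤ - w) * ∑ (range b (suc (m ∸ b))) (valueWeight w z))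
      ≡⟨ cong (x * B *_) (geometric-valueWeight w z b (m ∸ b)) ⟩
    x * B * (w ^ b - w ^ (b +ℕ suc (m ∸ b)) + (1ℤ - w) * ((z - 1ℤ) * 0ℤ ^ b))
      ≡⟨ cong (λ e → x * B * (w ^ b - w ^ e + (1ℤ - w) * ((z - 1ℤ) * 0ℤ ^ b))) b+[m+1∸b]≡m+1 ⟩
    x * B * (w ^ b - w ^ suc m + (1ℤ - w) * ((z - 1ℤ) * 0ℤ ^ b))
      ≡⟨ distribute x B (w ^ b) (w ^ suc m) (1ℤ - w) (z - 1ℤ) (0ℤ ^ b) ⟩
    x * (B * w ^ b - B * w ^ suc m) + (1ℤ - w) * (x * ((z - 1ℤ) * (B * 0ℤ ^ b)))
      ≡⟨ sym (cong₂ (λ V W → x * V + (1ℤ - w) * (x * ((z - 1ℤ) * W))) (cong₂ _-_ (weight w) weight-q*w) (weight 0ℤ)) ⟩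
    x * (wt x q w u z s - wt x (q * w) 1ℤ u z s) + (1ℤ - w) * (x * ((z - 1ℤ) * wt x q 0ℤ u z s)) ∎
    where
    open ≡-Reasoning
    s : List ℕ
    s = range 0 (suc m) ++ b ∷ r
    B : ℤ
    B = baseWeight s
    weight : ∀ w → wt x q w u z s ≡ B * w ^ b
    weight w = trans (wt-baseWeight w s) (cong (λ e → B * w ^ e) (ealm-fShape b≤m tail))
    weight-q*w : wt x (q * w) 1ℤ u z s ≡ B * w ^ suc m
    weight-q*w = trans (wt-q*w w s) (cong (λ e → B * w ^ e) (maxs-fShape b≤m tail))
    b+[m+1∸b]≡m+1 : b +ℕ suc (m ∸ b) ≡ suc m
    b+[m+1∸b]≡m+1 = trans (+-suc b (m ∸ b)) (cong suc (m+[n∸m]≡n b≤m))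
    distribute : ∀ x B W V c d O → x * B * (W - V + c * (d * O)) ≡ x * (B * W - B * V) + c * (x * (d * (B * O)))
    distribute = solve-∀

S2c≡∑-insertions : ∀ n x q w u z → S2c (suc n) x q w u z ≡ ∑[ s ∈ filterᵇ inF (invSeqs n) ] ∑ (insertions s) (wt x q w u z)
S2c≡∑-insertions n x q w u z = begin
  sumWhere inS2 f (invSeqs (suc n))                     ≡⟨ sumWhere≡∑-filterᵇ inS2 f (invSeqs (suc n)) ⟩
  ∑ (filterᵇ inS2 (invSeqs (suc n))) f                  ≡⟨ ∑-↭ f (S2-↭-insertions n) ⟩
  ∑ (concatMap insertions (filterᵇ inF (invSeqs n))) f  ≡⟨ ∑-concatMap insertions (filterᵇ inF (invSeqs n)) f ⟩
  ∑[ s ∈ filterᵇ inF (invSeqs n) ] ∑ (insertions s) f   ∎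
  where
  open ≡-Reasoning
  f : List ℕ → ℤ
  f = wt x q w u z

lemma2p3 : ∀ (x q w u z : ℤ) →
    (S2c 0 x q w u z ≡ + 0) ×
    (∀ (n : ℕ) →
      (+ 1 - w) * S2c (suc n) x q w u z
        ≡ x * (Fc n x q w u z - Fc n x (q * w) (+ 1) u z)
          + (+ 1 - w) * (x * ((z - + 1) * Fc n x q (+ 0) u z)))
lemma2p3 x q w u z = refl , λ n → let Fs = filterᵇ inF (invSeqs n) in begin
  (1ℤ - w) * S2c (suc n) x q w u z
    ≡⟨ cong ((1ℤ - w) *_) (S2c≡∑-insertions n x q w u z) ⟩
  (1ℤ - w) * (∑[ s ∈ Fs ] ∑ (insertions s) f)
    ≡⟨ sym (∑-*ˡ Fs (1ℤ - w) _) ⟩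
  ∑[ s ∈ Fs ] (1ℤ - w) * ∑ (insertions s) f
    ≡⟨ ∑-cong (λ s∈ → insertions-weight x q u z w (∈-filter-inF⇒FShape n s∈)) ⟩
  ∑[ s ∈ Fs ] (x * (f s - g s) + (1ℤ - w) * (x * ((z - 1ℤ) * h s)))
    ≡⟨ ∑-combination Fs x (1ℤ - w) (z - 1ℤ) f g h ⟩
  x * (∑ Fs f - ∑ Fs g) + (1ℤ - w) * (x * ((z - 1ℤ) * ∑ Fs h))
    ≡⟨ sym (cong₂ (λ F G → x * F + (1ℤ - w) * (x * ((z - 1ℤ) * G)))
                  (cong₂ _-_ (sumWhere≡∑-filterᵇ inF f (invSeqs n)) (sumWhere≡∑-filterᵇ inF g (invSeqs n))) (sumWhere≡∑-filterᵇ inF h (invSeqs n))) ⟩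
  x * (Fc n x q w u z - Fc n x (q * w) 1ℤ u z) + (1ℤ - w) * (x * ((z - 1ℤ) * Fc n x q 0ℤ u z)) ∎
  where
  open ≡-Reasoning
  f g h : List ℕ → ℤ
  f = wt x q w u z
  g = wt x (q * w) 1ℤ u z
  h = wt x q 0ℤ u z
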